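{- Let $q,e,r$ be positive integers such that $\gcd(q,e)=1$ and $1<q<e$, and set $e_1 := \gcd(e,q-1)$. Consider the condition $(\ast)$: $a,b$ are positive integers with $\gcd(a,b)=1$, $b<a\le r$, $ab\le q$ and $e = \frac{a}{b}(q-1)$. (i) If there exist positive integers $a,b$ satisfying $(\ast)$, then $m(q,e) = e_1 = \frac{e}{a} \ge \frac{e}{r}$. (ii) Conversely, if $m(q,e) \ge \frac{e}{r}$ and $e > r^4 - 2r^2$, then there exist positive integers $a,b$ satisfying $(\ast)$.
   Context: For coprime positive integers $q,e$, $m(q,e)$ denotes the least positive integer $t$ such that there exist nonnegative integers $a_1,\ldots,a_t$ (repetitions allowed) with $q^{a_1}+\cdots+q^{a_t} \equiv 0 \pmod e$. -}

module Defs where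

open import Data.Nat using (ℕ; _*_; _^_; _≤_; _<_)
open import Data.Nat.Divisibility using (_∣_)
open import Data.List using (List; length; map)
open import Data.Nat.ListAction using (sum)
open import Data.Product using (_×_; ∃-syntax)
open import Relation.Binary.PropositionalEquality using (_≡_)

Representable : ℕ → ℕ → ℕ → Set
Representable q e t = ∃[ as ] (length as ≡ t) × (e ∣ sum (map (q ^_) as))

-- IsM q e t : t = m(q,e), i.e. t is the least positive integer that is Representable.
IsM : ℕ → ℕ → ℕ → Set
IsM q e t = (0 < t) × Representable q e t × (∀ s → 0 < s → Representable q e s → t ≤ s)

{-# OPTIONS --safe #-}
module Submission where

-- From b e = a (q − 1) and gcd(a, b) = 1 we get e = c a with q = 1 + b c, so every power of q
-- is 1 modulo c: a sum of t powers of q divisible by e forces c ∣ t, while (c − x) + x q = c (1 + x b),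
-- with x < a chosen so that a ∣ 1 + x b, is such a sum with t = c.
--
-- Put N = ⌊√e⌋. Two of the (N + 1)² numbers x + y q with x, y ≤ N agree modulo e; the
-- difference is either a sum x + y q ≡ 0 (mod e) of length ≤ 2N < e / r, or a congruence v q ≡ u
-- (mod e) with 0 < u, v ≤ N. In the latter case some point of the line v x + u y = e satisfies
-- x + y q ≡ 0 (mod e) and has one coordinate smaller than max(u, v), which again gives a sum of length
-- < e / r unless u = v ≤ r, and then (a, b) = (v, (v q − v) / e) satisfies (∗). If u ≠ v are both ≤ r,
-- we first cancel g = gcd(u, v) and raise the congruence to a power until its larger coefficient
-- exceeds r. The bound e > r⁴ − 2r² makes all the resulting estimates work, except for r = 2 and
-- e ≤ 16, which is settled by computation.

open import Defs
open import Data.Nat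
open import Data.Nat.Properties
open import Data.Nat.Divisibility
open import Data.Nat.DivMod using (_%_; _/_; m≡m%n+[m/n]*n; m%n<n)
open import Data.Nat.GCD using (gcd; gcd[m,n]∣m; gcd[m,n]∣n; gcd[m,n]≢0; c*gcd[m,n]≡gcd[cm,cn]; module Bézout)
open import Data.Nat.Coprimality using (Coprime; coprime-/gcd; coprime-Bézout; coprime-divisor; gcd≡1⇒coprime; coprime⇒gcd≡1) renaming (sym to Coprime-sym)
open import Data.Nat.ListAction using (sum)
open import Data.Nat.ListAction.Properties using (sum-++)
open import Data.Nat.Tactic.RingSolver using (solve-∀)
open import Data.List using (List; []; _∷_; length; map; replicate; _++_)
open import Data.List.Properties using (length-++; length-replicate; map-++; map-replicate)
open import Data.Product using (∃-syntax; ∃₂; _×_; _,_; proj₁; proj₂; uncurry)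
open import Data.Fin using (Fin; toℕ; fromℕ<; remQuot; combine)
open import Data.Fin.Properties using (pigeonhole; toℕ<n; toℕ-fromℕ<; toℕ-injective; combine-remQuot; all?; any?)
open import Data.Sum using (_⊎_; inj₁; inj₂)
open import Data.Empty using (⊥; ⊥-elim)
open import Relation.Nullary using (¬_; Dec; yes; no)
open import Relation.Nullary.Decidable using (_×-dec_; _⊎-dec_; _→-dec_; toWitness)
open import Relation.Binary.Definitions using (tri<; tri≈; tri>)
open import Relation.Binary.PropositionalEquality

sum-replicate : ∀ n k → sum (replicate n k) ≡ n * k
sum-replicate zero    k = refl
sum-replicate (suc n) k = cong (k +_) (sum-replicate n k)

Representable-twoTerms : ∀ q e x y j → e ∣ x + y * q ^ j → Representable q e (x + y)
Representable-twoTerms q e x y j e∣ = as , length-as , subst (e ∣_) (sym sum-as) e∣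
  where
  as : List ℕ
  as = replicate x 0 ++ replicate y j
  length-as : length as ≡ x + y
  length-as = trans (length-++ (replicate x 0)) (cong₂ _+_ (length-replicate x) (length-replicate y))
  sum-as : sum (map (q ^_) as) ≡ x + y * q ^ j
  sum-as = begin
    sum (map (q ^_) as)                                        ≡⟨ cong sum (map-++ (q ^_) (replicate x 0) (replicate y j)) ⟩
    sum (map (q ^_) (replicate x 0) ++ map (q ^_) (replicate y j)) ≡⟨ sum-++ (map (q ^_) (replicate x 0)) _ ⟩
    sum (map (q ^_) (replicate x 0)) + sum (map (q ^_) (replicate y j))
      ≡⟨ cong₂ _+_ (cong sum (map-replicate (q ^_) x 0)) (cong sum (map-replicate (q ^_) y j)) ⟩
    sum (replicate x 1) + sum (replicate y (q ^ j))             ≡⟨ cong₂ _+_ (trans (sum-replicate x 1) (*-identityʳ x)) (sum-replicate y (q ^ j)) ⟩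
    x + y * q ^ j ∎
    where open ≡-Reasoning

IsM⇒≤twoTerms : ∀ {q e m} x y j → IsM q e m → 0 < x + y → e ∣ x + y * q ^ j → m ≤ x + y
IsM⇒≤twoTerms {q} {e} x y j (_ , _ , least) 0<x+y e∣ =
  least (x + y) 0<x+y (Representable-twoTerms q e x y j e∣)

ShortRepresentation : ℕ → ℕ → ℕ → Set
ShortRepresentation q e r = ∃[ x ] ∃[ y ] ∃[ j ] 0 < x + y × r * (x + y) < e × e ∣ x + y * q ^ j

IsM⇒¬ShortRepresentation : ∀ {q e m r} → IsM q e m → e ≤ m * r → ¬ ShortRepresentation q e r
IsM⇒¬ShortRepresentation {m = m} {r} isM e≤mr (x , y , j , 0<x+y , r[x+y]<e , e∣) = <⇒≱ r[x+y]<e (begin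
  _             ≤⟨ e≤mr ⟩
  m * r         ≤⟨ *-monoˡ-≤ r (IsM⇒≤twoTerms x y j isM 0<x+y e∣) ⟩
  (x + y) * r   ≡⟨ *-comm (x + y) r ⟩
  r * (x + y)   ∎)
  where open ≤-Reasoning

ShortRepresentation[q¹] : ∀ {q e r} x y → 0 < x + y → r * (x + y) < e → e ∣ x + y * q → ShortRepresentation q e r
ShortRepresentation[q¹] {q} {e} x y 0<x+y r[x+y]<e e∣ =
  x , y , 1 , 0<x+y , r[x+y]<e , subst (λ t → e ∣ x + y * t) (sym (*-identityʳ q)) e∣

ShortRepresentation-scale : ∀ {q e r E g} x y j → e ≡ g * E → 0 < g → 0 < x + y → E ∣ x + y * q ^ j →
                            r * (g * (x + y)) < e → ShortRepresentation q e r
ShortRepresentation-scale {q} {e} {r} {E} {g} x y j e≡gE 0<g 0<x+y E∣ r[g[x+y]]<e =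
  g * x , g * y , j , subst (0 <_) (*-distribˡ-+ g x y) (*-mono-≤ 0<g 0<x+y) ,
  subst (λ t → r * t < e) (*-distribˡ-+ g x y) r[g[x+y]]<e , subst₂ _∣_ (sym e≡gE) (ring g x y (q ^ j)) (*-monoʳ-∣ g E∣)
  where
  ring : ∀ g x y Q → g * (x + y * Q) ≡ g * x + g * y * Q
  ring = solve-∀

-- The case of an exceptional pair

n∣1+y*k⇒n∣1+[y%n]*k : ∀ n y k .{{_ : NonZero n}} → n ∣ 1 + y * k → n ∣ 1 + y % n * k
n∣1+y*k⇒n∣1+[y%n]*k n y k n∣ = ∣m+n∣m⇒∣n (subst (n ∣_) split n∣) (∣m⇒∣m*n k (n∣m*n (y / n)))
  where
  split : 1 + y * k ≡ y / n * n * k + (1 + y % n * k)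
  split = begin
    1 + y * k                          ≡⟨ cong (λ z → 1 + z * k) (m≡m%n+[m/n]*n y n) ⟩
    1 + (y % n + y / n * n) * k        ≡⟨ ring (y % n) (y / n * n) k ⟩
    y / n * n * k + (1 + y % n * k)    ∎
    where
    open ≡-Reasoning
    ring : ∀ r t k → 1 + (r + t) * k ≡ t * k + (1 + r * k)
    ring = solve-∀

coprime⇒∃[y]n∣1+y*k : ∀ {w k} → Coprime (suc w) k → ∃[ y ] suc w ∣ 1 + y * k
coprime⇒∃[y]n∣1+y*k {w} {k} coprime with coprime-Bézout coprime
... | Bézout.+- x y eq = y , divides x eq
... | Bézout.-+ x y eq = w * y , divides (1 + w * x) (begin
  1 + w * y * k             ≡⟨ cong (1 +_) (*-assoc w y k) ⟩
  1 + w * (y * k)           ≡⟨ cong (λ z → 1 + w * z) eq ⟨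
  1 + w * (1 + x * suc w)   ≡⟨ ring w x ⟩
  (1 + w * x) * suc w       ∎)
  where
  open ≡-Reasoning
  ring : ∀ w x → 1 + w * (1 + x * suc w) ≡ (1 + w * x) * suc w
  ring = solve-∀

coprime⇒∃[y<n]n∣1+y*k : ∀ {w k} → Coprime (suc w) k → ∃[ y ] y < suc w × suc w ∣ 1 + y * k
coprime⇒∃[y<n]n∣1+y*k {w} {k} coprime with coprime⇒∃[y]n∣1+y*k coprime
... | y , n∣ = y % suc w , m%n<n y (suc w) , n∣1+y*k⇒n∣1+[y%n]*k (suc w) y k n∣

module _ {q b c : ℕ} (q≡ : q ≡ 1 + b * c) where

  ^≡1+[*c] : ∀ j → ∃[ t ] q ^ j ≡ 1 + t * c
  ^≡1+[*c] zero = 0 , refl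
  ^≡1+[*c] (suc j) with ^≡1+[*c] j
  ... | t , q^j≡ = b + t + b * c * t , trans (cong₂ _*_ q≡ q^j≡) (ring b c t)
    where
    ring : ∀ b c t → (1 + b * c) * (1 + t * c) ≡ 1 + (b + t + b * c * t) * c
    ring = solve-∀

  sum-powers≡length+[*c] : ∀ as → ∃[ T ] sum (map (q ^_) as) ≡ length as + T * c
  sum-powers≡length+[*c] [] = 0 , refl
  sum-powers≡length+[*c] (j ∷ as) with ^≡1+[*c] j | sum-powers≡length+[*c] as
  ... | t , q^j≡ | T , sum≡ = t + T , trans (cong₂ _+_ q^j≡ sum≡) (ring t T (length as) c)
    where
    ring : ∀ t T l c → 1 + t * c + (l + T * c) ≡ suc l + (t + T) * c
    ring = solve-∀

  ∣sum-powers⇒∣length : ∀ as → c ∣ sum (map (q ^_) as) → c ∣ length as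
  ∣sum-powers⇒∣length as c∣ with sum-powers≡length+[*c] as
  ... | T , sum≡ = ∣m+n∣m⇒∣n (subst (c ∣_) (trans sum≡ (+-comm (length as) (T * c))) c∣) (n∣m*n T)

IsM-c*a : ∀ {q a b c} → 1 < q → 0 < a → Coprime a b → a * b ≤ q → q ≡ 1 + b * c → IsM q (c * a) c
IsM-c*a {q} {suc w} {b} {c} 1<q _ coprime ab≤q q≡ with coprime⇒∃[y<n]n∣1+y*k coprime
... | x , x<a , a∣ = 0<c , subst (Representable q (c * suc w)) (m∸n+n≡m x≤c) representable , least
  where
  open ≤-Reasoning
  a = suc w
  0<bc : 0 < b * c
  0<bc = +-cancelˡ-< 1 0 (b * c) (subst (1 <_) q≡ 1<q)
  0<c : 0 < c
  0<c = n≢0⇒n>0 λ { refl → <-irrefl (sym (*-zeroʳ b)) 0<bc }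
  0<b : 0 < b
  0<b = n≢0⇒n>0 λ { refl → <-irrefl refl 0<bc }
  a≤1+c : a ≤ suc c
  a≤1+c = ≮⇒≥ λ 1+c<a → <-irrefl refl (begin-strict
    q                 ≡⟨ q≡ ⟩
    1 + b * c         <⟨ +-monoˡ-< (b * c) (+-mono-≤-< 0<b 0<b) ⟩
    b + b + b * c     ≡⟨ ring b c ⟩
    (2 + c) * b       ≤⟨ *-monoˡ-≤ b 1+c<a ⟩
    a * b             ≤⟨ ab≤q ⟩
    q                 ∎)
    where
    ring : ∀ b c → b + b + b * c ≡ (2 + c) * b
    ring = solve-∀
  x≤c : x ≤ c
  x≤c = s≤s⁻¹ (≤-trans x<a a≤1+c)
  representable : Representable q (c * a) (c ∸ x + x)
  representable = Representable-twoTerms q (c * a) (c ∸ x) x 1 (subst (c * a ∣_) (sym sum≡) (*-monoʳ-∣ c a∣))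
    where
    sum≡ : c ∸ x + x * q ^ 1 ≡ c * (1 + x * b)
    sum≡ = begin-equality
      c ∸ x + x * q ^ 1           ≡⟨ cong (λ z → c ∸ x + x * z) (trans (*-identityʳ q) q≡) ⟩
      c ∸ x + x * (1 + b * c)     ≡⟨ ring (c ∸ x) x b c ⟩
      c ∸ x + x + x * b * c       ≡⟨ cong (_+ x * b * c) (m∸n+n≡m x≤c) ⟩
      c + x * b * c               ≡⟨ ring′ c x b ⟩
      c * (1 + x * b)             ∎
      where
      ring : ∀ d x b c → d + x * (1 + b * c) ≡ d + x + x * b * c
      ring = solve-∀
      ring′ : ∀ c x b → c + x * b * c ≡ c * (1 + x * b)
      ring′ = solve-∀
  least : ∀ t → 0 < t → Representable q (c * a) t → c ≤ t
  least t 0<t (as , refl , ca∣) = ∣⇒≤ {{>-nonZero 0<t}} (∣sum-powers⇒∣length {b = b} q≡ as (∣-trans (m∣m*n a) ca∣))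

exceptionalPair⇒e≡c*a : ∀ {q e a b} → 1 < q → 0 < a → Coprime a b → b * e ≡ a * (q ∸ 1) →
                         ∃[ c ] e ≡ c * a × q ≡ 1 + b * c × gcd e (q ∸ 1) ≡ c
exceptionalPair⇒e≡c*a {q} {e} {a} {b} 1<q 0<a coprime be≡ = c , e≡ca , q≡ , gcd≡c
  where
  a∣e : a ∣ e
  a∣e = coprime-divisor coprime (divides (q ∸ 1) (trans be≡ (*-comm a (q ∸ 1))))
  c = quotient a∣e
  e≡ca : e ≡ c * a
  e≡ca = _∣_.equality a∣e
  bc≡q-1 : b * c ≡ q ∸ 1
  bc≡q-1 = *-cancelʳ-≡ (b * c) (q ∸ 1) a {{>-nonZero 0<a}}
    (trans (*-assoc b c a) (trans (cong (b *_) (sym e≡ca)) (trans be≡ (*-comm a (q ∸ 1)))))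
  q≡ : q ≡ 1 + b * c
  q≡ = trans (sym (m+[n∸m]≡n (<⇒≤ 1<q))) (cong (1 +_) (sym bc≡q-1))
  gcd≡c : gcd e (q ∸ 1) ≡ c
  gcd≡c = begin
    gcd e (q ∸ 1)       ≡⟨ cong₂ gcd e≡ca (trans (sym bc≡q-1) (*-comm b c)) ⟩
    gcd (c * a) (c * b) ≡⟨ c*gcd[m,n]≡gcd[cm,cn] c a b ⟨
    c * gcd a b         ≡⟨ cong (c *_) (coprime⇒gcd≡1 coprime) ⟩
    c * 1               ≡⟨ *-identityʳ c ⟩
    c                   ∎
    where open ≡-Reasoning

exceptionalPair⇒IsM : ∀ {q e r a b} → 1 < q → 0 < a → gcd a b ≡ 1 → a ≤ r → a * b ≤ q → b * e ≡ a * (q ∸ 1) →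
                      IsM q e (gcd e (q ∸ 1)) × (gcd e (q ∸ 1) * a ≡ e) × (e ≤ gcd e (q ∸ 1) * r)
exceptionalPair⇒IsM 1<q 0<a gcd≡1 a≤r ab≤q be≡ with exceptionalPair⇒e≡c*a 1<q 0<a (gcd≡1⇒coprime gcd≡1) be≡
... | c , refl , q≡ , gcd≡c rewrite gcd≡c =
  IsM-c*a 1<q 0<a (gcd≡1⇒coprime gcd≡1) ab≤q q≡ , refl , *-monoʳ-≤ c a≤r

-- Lattice points on the line V x + U y = E

module _ {E Q U V K : ℕ} (VQ≡ : V * Q ≡ U + K * E) where

  ∃lineSolution[y<V] : ∀ {w} → V ≡ suc w → Coprime V K → U * w ≤ E →
                       ∃[ x ] ∃[ y ] y < V × V * x + U * y ≡ E × E ∣ x + y * Q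
  -- With V ∣ 1 + y K, the point x = E (1 + y K) / V − y Q lies on the line.
  ∃lineSolution[y<V] {w} refl coprime Uw≤E with coprime⇒∃[y<n]n∣1+y*k coprime
  ... | y , y<V , divides z zV≡ = x , y , y<V , on-line , divides z (trans x+yQ≡Ez (*-comm E z))
    where
    open ≤-Reasoning
    VyQ≡ : V * (y * Q) ≡ y * U + y * K * E
    VyQ≡ = begin-equality
      V * (y * Q)       ≡⟨ ring V y Q ⟩
      y * (V * Q)       ≡⟨ cong (y *_) VQ≡ ⟩
      y * (U + K * E)   ≡⟨ ring′ y U K E ⟩
      y * U + y * K * E ∎
      where
      ring : ∀ V y Q → V * (y * Q) ≡ y * (V * Q)
      ring = solve-∀
      ring′ : ∀ y U K E → y * (U + K * E) ≡ y * U + y * K * E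
      ring′ = solve-∀
    VEz≡ : V * (E * z) ≡ E + y * K * E
    VEz≡ = begin-equality
      V * (E * z)       ≡⟨ ring V E z ⟩
      E * (z * V)       ≡⟨ cong (E *_) zV≡ ⟨
      E * (1 + y * K)   ≡⟨ ring′ E y K ⟩
      E + y * K * E     ∎
      where
      ring : ∀ V E z → V * (E * z) ≡ E * (z * V)
      ring = solve-∀
      ring′ : ∀ E y K → E * (1 + y * K) ≡ E + y * K * E
      ring′ = solve-∀
    yU≤E : y * U ≤ E
    yU≤E = ≤-trans (*-monoˡ-≤ U (s≤s⁻¹ y<V)) (≤-trans (≤-reflexive (*-comm w U)) Uw≤E)
    yQ≤Ez : y * Q ≤ E * z
    yQ≤Ez = *-cancelˡ-≤ V (begin
      V * (y * Q)       ≡⟨ VyQ≡ ⟩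
      y * U + y * K * E ≤⟨ +-monoˡ-≤ (y * K * E) yU≤E ⟩
      E + y * K * E     ≡⟨ VEz≡ ⟨
      V * (E * z)       ∎)
    x = E * z ∸ y * Q
    x+yQ≡Ez : x + y * Q ≡ E * z
    x+yQ≡Ez = m∸n+n≡m yQ≤Ez
    on-line : V * x + U * y ≡ E
    on-line = +-cancelʳ-≡ (y * K * E) _ _ (begin-equality
      V * x + U * y + y * K * E     ≡⟨ +-assoc (V * x) (U * y) (y * K * E) ⟩
      V * x + (U * y + y * K * E)   ≡⟨ cong (λ t → V * x + (t + y * K * E)) (*-comm U y) ⟩
      V * x + (y * U + y * K * E)   ≡⟨ cong (V * x +_) VyQ≡ ⟨
      V * x + V * (y * Q)           ≡⟨ *-distribˡ-+ V x (y * Q) ⟨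
      V * (x + y * Q)               ≡⟨ cong (V *_) x+yQ≡Ez ⟩
      V * (E * z)                   ≡⟨ VEz≡ ⟩
      E + y * K * E                 ∎)

  ∃lineSolution[x<U] : ∀ {w u} → V ≡ suc w → Coprime V K → U * w ≤ E → U ≡ suc u →
                       ∃[ x ] ∃[ y ] x < U × V * x + U * y ≡ E × E ∣ x + y * Q
  ∃lineSolution[x<U] V≡ coprime Uw≤E refl with ∃lineSolution[y<V] V≡ coprime Uw≤E
  ... | x₀ , y₀ , _ , on-line₀ , E∣₀ = x , y₀ + t * V , m%n<n x₀ U , on-line , E∣
    where
    open ≡-Reasoning
    x = x₀ % U
    t = x₀ / U
    x₀≡ : x₀ ≡ x + t * U
    x₀≡ = m≡m%n+[m/n]*n x₀ U
    on-line : V * x + U * (y₀ + t * V) ≡ E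
    on-line = begin
      V * x + U * (y₀ + t * V)   ≡⟨ ring V x U y₀ t ⟩
      V * (x + t * U) + U * y₀   ≡⟨ cong (λ z → V * z + U * y₀) x₀≡ ⟨
      V * x₀ + U * y₀            ≡⟨ on-line₀ ⟩
      E                          ∎
      where
      ring : ∀ V x U y₀ t → V * x + U * (y₀ + t * V) ≡ V * (x + t * U) + U * y₀
      ring = solve-∀
    E∣ : E ∣ x + (y₀ + t * V) * Q
    E∣ = subst (E ∣_) (sym (begin
      x + (y₀ + t * V) * Q             ≡⟨ ring x y₀ t V Q ⟩
      x + y₀ * Q + t * (V * Q)         ≡⟨ cong (λ z → x + y₀ * Q + t * z) VQ≡ ⟩
      x + y₀ * Q + t * (U + K * E)     ≡⟨ ring′ x y₀ t U K E Q ⟩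
      (x + t * U) + y₀ * Q + t * K * E ≡⟨ cong (λ z → z + y₀ * Q + t * K * E) x₀≡ ⟨
      x₀ + y₀ * Q + t * K * E          ∎))
      (∣m∣n⇒∣m+n E∣₀ (n∣m*n (t * K)))
      where
      ring : ∀ x y₀ t V Q → x + (y₀ + t * V) * Q ≡ x + y₀ * Q + t * (V * Q)
      ring = solve-∀
      ring′ : ∀ x y₀ t U K E Q → x + y₀ * Q + t * (U + K * E) ≡ (x + t * U) + y₀ * Q + t * K * E
      ring′ = solve-∀

0<A*x+B*y⇒0<x+y : ∀ A B x y → 0 < A * x + B * y → 0 < x + y
0<A*x+B*y⇒0<x+y A B zero    zero    0<A0+B0 = ⊥-elim (<-irrefl (sym (cong₂ _+_ (*-zeroʳ A) (*-zeroʳ B))) 0<A0+B0)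
0<A*x+B*y⇒0<x+y A B zero    (suc y) _       = z<s
0<A*x+B*y⇒0<x+y A B (suc x) y       _       = z<s

module _ {E Q U V K : ℕ} (VQ≡ : V * Q ≡ U + K * E) (coprime : Coprime V K) (0<E : 0 < E) where

  ∃shortSolution[y<V] : ∀ {w} → V ≡ suc w → U * w ≤ E →
                        ∃[ x ] ∃[ y ] 0 < x + y × y < V × V * x ≤ E × E ∣ x + y * Q
  ∃shortSolution[y<V] V≡ Uw≤E with x , y , y<V , on-line , E∣ ← ∃lineSolution[y<V] VQ≡ V≡ coprime Uw≤E =
    x , y , 0<A*x+B*y⇒0<x+y V U x y (subst (0 <_) (sym on-line) 0<E) , y<V , subst (V * x ≤_) on-line (m≤m+n (V * x) (U * y)) , E∣

  ∃shortSolution[x<U] : ∀ {w u} → V ≡ suc w → U * w ≤ E → U ≡ suc u →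
                        ∃[ x ] ∃[ y ] 0 < x + y × x < U × U * y ≤ E × E ∣ x + y * Q
  ∃shortSolution[x<U] V≡ Uw≤E U≡ with x , y , x<U , on-line , E∣ ← ∃lineSolution[x<U] VQ≡ V≡ coprime Uw≤E U≡ =
    x , y , 0<A*x+B*y⇒0<x+y V U x y (subst (0 <_) (sym on-line) 0<E) , x<U , subst (U * y ≤_) on-line (m≤n+m (U * y) (V * x)) , E∣

relation-/-common-factor : ∀ {q e u v k} g u′ v′ k′ e′ .{{_ : NonZero g}} →
  u ≡ u′ * g → v ≡ v′ * g → k * e ≡ k′ * e′ * g → v * q ≡ u + k * e → v′ * q ≡ u′ + k′ * e′
relation-/-common-factor {q} {e} {u} {v} {k} g u′ v′ k′ e′ u≡ v≡ ke≡ vq≡ = *-cancelʳ-≡ _ _ g (begin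
  v′ * q * g             ≡⟨ ring v′ q g ⟩
  v′ * g * q             ≡⟨ cong (_* q) v≡ ⟨
  v * q                  ≡⟨ vq≡ ⟩
  u + k * e              ≡⟨ cong₂ _+_ u≡ ke≡ ⟩
  u′ * g + k′ * e′ * g   ≡⟨ *-distribʳ-+ g u′ (k′ * e′) ⟨
  (u′ + k′ * e′) * g     ∎)
  where
  open ≡-Reasoning
  ring : ∀ v′ q g → v′ * q * g ≡ v′ * g * q
  ring = solve-∀

coprime-quotients-gcd : ∀ m n .{{_ : NonZero (gcd m n)}} →
                        Coprime (quotient (gcd[m,n]∣m m n)) (quotient (gcd[m,n]∣n m n))
coprime-quotients-gcd m n =
  subst₂ Coprime (n/m≡quotient (gcd[m,n]∣m m n)) (n/m≡quotient (gcd[m,n]∣n m n)) (coprime-/gcd m n)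

quotient-≤ : ∀ {d n} .{{_ : NonZero n}} (d∣n : d ∣ n) → quotient d∣n ≤ n
quotient-≤ d∣n = ∣⇒≤ (quotient-∣ d∣n)

quotient-pos : ∀ {d n} → 0 < n → (d∣n : d ∣ n) → 0 < quotient d∣n
quotient-pos 0<n d∣n = >-nonZero⁻¹ _ {{quotient≢0 d∣n {{>-nonZero 0<n}}}}

coprime-*ʳ : ∀ {a b c} → Coprime a b → Coprime a c → Coprime a (b * c)
coprime-*ʳ coprime-ab coprime-ac (d∣a , d∣bc) =
  coprime-ac (d∣a , coprime-divisor (λ (d′∣d , d′∣b) → coprime-ab (∣-trans d′∣d d∣a , d′∣b)) d∣bc)

coprime-^ʳ : ∀ {a b} j → Coprime a b → Coprime a (b ^ j)
coprime-^ʳ zero    _        (_ , d∣1) = ∣1⇒≡1 d∣1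
coprime-^ʳ (suc j) coprime = coprime-*ʳ coprime (coprime-^ʳ j coprime)

coprime-^ : ∀ {a b} j → Coprime a b → Coprime (a ^ j) (b ^ j)
coprime-^ j coprime = Coprime-sym (coprime-^ʳ j (Coprime-sym (coprime-^ʳ j coprime)))

relation-^ : ∀ {E q u v k} → v * q ≡ u + k * E → ∀ j → ∃[ K ] v ^ j * q ^ j ≡ u ^ j + K * E
relation-^ vq≡ zero = 0 , refl
relation-^ {E} {q} {u} {v} {k} vq≡ (suc j) with K , vʲqʲ≡ ← relation-^ {k = k} vq≡ j =
  u * K + k * u ^ j + k * K * E , (begin
    v * v ^ j * (q * q ^ j)            ≡⟨ ring v (v ^ j) q (q ^ j) ⟩
    (v * q) * (v ^ j * q ^ j)          ≡⟨ cong₂ _*_ vq≡ vʲqʲ≡ ⟩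
    (u + k * E) * (u ^ j + K * E)      ≡⟨ ring′ u k E (u ^ j) K ⟩
    u * u ^ j + (u * K + k * u ^ j + k * K * E) * E ∎)
  where
  open ≡-Reasoning
  ring : ∀ v vʲ q qʲ → v * vʲ * (q * qʲ) ≡ (v * q) * (vʲ * qʲ)
  ring = solve-∀
  ring′ : ∀ u k E uʲ K → (u + k * E) * (uʲ + K * E) ≡ u * uʲ + (u * K + k * uʲ + k * K * E) * E
  ring′ = solve-∀

relation⇒coprime : ∀ {E Q U V K} → V * Q ≡ U + K * E → Coprime V U → Coprime V K
relation⇒coprime {E} {Q} {U} {V} {K} VQ≡ coprime {d} (d∣V , d∣K) =
  coprime (d∣V , ∣m+n∣m⇒∣n (subst (d ∣_) (trans VQ≡ (+-comm U (K * E))) (∣m⇒∣m*n Q d∣V)) (∣m⇒∣m*n E d∣K))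

-- The pigeonhole step

data SmallRelation (e q N : ℕ) : Set where
  zero-sum   : ∀ {x y} → x ≤ N → y ≤ N → 0 < y → e ∣ x + y * q → SmallRelation e q N
  congruence : ∀ {u v k} → 0 < u → u ≤ N → 0 < v → v ≤ N → v * q ≡ u + k * e → Coprime v k →
               SmallRelation e q N

reduced-congruence : ∀ {e q N u v k} → 0 < u → u ≤ N → 0 < v → v ≤ N → v * q ≡ u + k * e →
                     SmallRelation e q N
reduced-congruence {e} {q} {N} {u} {v} {k} 0<u u≤N 0<v v≤N vq≡ =
  congruence (quotient-pos 0<u g∣u) (≤-trans (quotient-≤ {{>-nonZero 0<u}} g∣u) u≤N)
             (quotient-pos 0<v g∣v) (≤-trans (quotient-≤ {{>-nonZero 0<v}} g∣v) v≤N)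
             (relation-/-common-factor {k = k} (gcd v k) (quotient g∣u) (quotient g∣v) (quotient g∣k) e
               (_∣_.equality g∣u) (_∣_.equality g∣v) ke≡ vq≡)
             (coprime-quotients-gcd v k)
  where
  instance
    g≢0 : NonZero (gcd v k)
    g≢0 = ≢-nonZero (gcd[m,n]≢0 v k (inj₁ (≢-nonZero⁻¹ v {{>-nonZero 0<v}})))
  g∣v = gcd[m,n]∣m v k
  g∣k = gcd[m,n]∣n v k
  g∣u : gcd v k ∣ u
  g∣u = ∣m+n∣m⇒∣n (subst (gcd v k ∣_) (trans vq≡ (+-comm u (k * e))) (∣m⇒∣m*n q g∣v)) (∣m⇒∣m*n e g∣k)
  ke≡ : k * e ≡ quotient g∣k * e * gcd v k
  ke≡ = trans (cong (_* e) (_∣_.equality g∣k)) (ring (quotient g∣k) (gcd v k) e)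
    where
    ring : ∀ k′ g e → k′ * g * e ≡ k′ * e * g
    ring = solve-∀

[c+s]%≡[c+t]%⇒∣t∸s : ∀ e c s t .{{_ : NonZero e}} → (c + s) % e ≡ (c + t) % e → e ∣ t ∸ s
[c+s]%≡[c+t]%⇒∣t∸s e c s t ≡% = divides ((c + t) / e ∸ (c + s) / e) (begin
  t ∸ s                                            ≡⟨ [m+n]∸[m+o]≡n∸o c t s ⟨
  (c + t) ∸ (c + s)                                ≡⟨ cong₂ _∸_ (m≡m%n+[m/n]*n (c + t) e) (m≡m%n+[m/n]*n (c + s) e) ⟩
  ((c + t) % e + (c + t) / e * e) ∸ ((c + s) % e + (c + s) / e * e)
                                                   ≡⟨ cong (λ z → ((c + t) % e + (c + t) / e * e) ∸ (z + (c + s) / e * e)) ≡% ⟩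
  ((c + t) % e + (c + t) / e * e) ∸ ((c + t) % e + (c + s) / e * e)
                                                   ≡⟨ [m+n]∸[m+o]≡n∸o ((c + t) % e) _ _ ⟩
  (c + t) / e * e ∸ (c + s) / e * e                ≡⟨ *-distribʳ-∸ e ((c + t) / e) ((c + s) / e) ⟨
  ((c + t) / e ∸ (c + s) / e) * e                  ∎)
  where open ≡-Reasoning

0<n<e⇒e∤n : ∀ {e n} → 0 < n → n < e → ¬ e ∣ n
0<n<e⇒e∤n 0<n n<e e∣n = <⇒≱ n<e (∣⇒≤ {{>-nonZero 0<n}} e∣n)

[c+u]%≡[c+w]%⇒w≡u+k*e : ∀ {e} c u w .{{_ : NonZero e}} → 0 < u → u < e → (c + u) % e ≡ (c + w) % e →
                         ∃[ k ] w ≡ u + k * e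
[c+u]%≡[c+w]%⇒w≡u+k*e {e} c u w 0<u u<e ≡% with u ≤? w
... | yes u≤w with divides k w∸u≡ ← [c+s]%≡[c+t]%⇒∣t∸s e c u w ≡% =
  k , trans (sym (m+[n∸m]≡n u≤w)) (cong (u +_) w∸u≡)
... | no  u≰w =
  ⊥-elim (0<n<e⇒e∤n (m<n⇒0<n∸m w<u) (≤-<-trans (m∸n≤m u w) u<e) ([c+s]%≡[c+t]%⇒∣t∸s e c w u (sym ≡%)))
  where
  w<u = ≰⇒> u≰w

collision⇒SmallRelation : ∀ {e q N x₁ y₁ x₂ v} .{{_ : NonZero e}} → N < e → x₁ ≤ N → x₂ ≤ N → y₁ + v ≤ N →
  ¬ (x₁ ≡ x₂ × v ≡ 0) → (x₁ + y₁ * q) % e ≡ (x₂ + (y₁ + v) * q) % e → SmallRelation e q N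
collision⇒SmallRelation {e} {q} {N} {x₁} {y₁} {x₂} {v} N<e x₁≤N x₂≤N y₁+v≤N distinct ≡% with x₁ ≤? x₂
... | yes x₁≤x₂ with s , refl ← m≤n⇒∃[o]m+o≡n x₁≤x₂ = sameRow-or-zeroSum (v ≟ 0)
  where
  e∣s+vq : e ∣ s + v * q
  e∣s+vq = [c+s]%≡[c+t]%⇒∣t∸s e (x₁ + y₁ * q) 0 (s + v * q)
    (trans (cong (_% e) (+-identityʳ _)) (trans ≡% (cong (_% e) (ring x₁ y₁ s v q))))
    where
    ring : ∀ x₁ y₁ s v q → x₁ + s + (y₁ + v) * q ≡ x₁ + y₁ * q + (s + v * q)
    ring = solve-∀
  sameRow-or-zeroSum : Dec (v ≡ 0) → SmallRelation e q N
  sameRow-or-zeroSum (yes v≡0) = ⊥-elim (0<n<e⇒e∤n 0<s (≤-<-trans (≤-trans (m≤n+m s x₁) x₂≤N) N<e) e∣s)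
    where
    0<s : 0 < s
    0<s = n≢0⇒n>0 λ { refl → distinct (sym (+-identityʳ x₁) , v≡0) }
    e∣s : e ∣ s
    e∣s = subst (e ∣_) (+-identityʳ s) (subst (λ t → e ∣ s + t * q) v≡0 e∣s+vq)
  sameRow-or-zeroSum (no v≢0) =
    zero-sum (≤-trans (m≤n+m s x₁) x₂≤N) (≤-trans (m≤n+m v y₁) y₁+v≤N) (n≢0⇒n>0 v≢0) e∣s+vq
... | no x₁≰x₂ with u , refl ← m≤n⇒∃[o]m+o≡n (≰⇒> x₁≰x₂)
  with [c+u]%≡[c+w]%⇒w≡u+k*e (x₂ + y₁ * q) (suc u) (v * q) z<s (≤-<-trans 1+u≤N N<e) ≡%′
  where
  1+u≤N : suc u ≤ N
  1+u≤N = ≤-trans (s≤s (m≤n+m u x₂)) x₁≤N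
  ≡%′ : (x₂ + y₁ * q + suc u) % e ≡ (x₂ + y₁ * q + v * q) % e
  ≡%′ = trans (cong (_% e) (ring x₂ u y₁ q)) (trans ≡% (cong (_% e) (ring′ x₂ y₁ v q)))
    where
    ring : ∀ x₂ u y₁ q → x₂ + y₁ * q + suc u ≡ suc x₂ + u + y₁ * q
    ring = solve-∀
    ring′ : ∀ x₂ y₁ v q → x₂ + (y₁ + v) * q ≡ x₂ + y₁ * q + v * q
    ring′ = solve-∀
... | k , vq≡ = reduced-congruence {k = k} z<s 1+u≤N 0<v (≤-trans (m≤n+m v y₁) y₁+v≤N) vq≡
  where
  1+u≤N : suc u ≤ N
  1+u≤N = ≤-trans (s≤s (m≤n+m u x₂)) x₁≤N
  0<v : 0 < v
  0<v = n≢0⇒n>0 λ { refl → 0≢1+n vq≡ }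

pigeonhole⇒SmallRelation : ∀ e q N .{{_ : NonZero e}} → N < e → e < suc N * suc N → SmallRelation e q N
pigeonhole⇒SmallRelation e q N N<e e<[1+N]² = fromCollision (pigeonhole e<[1+N]² residue)
  where
  Point = Fin (suc N * suc N)
  x y : Point → ℕ
  x k = toℕ (proj₁ (remQuot {suc N} (suc N) k))
  y k = toℕ (proj₂ (remQuot {suc N} (suc N) k))
  x≤N : ∀ k → x k ≤ N
  x≤N k = s≤s⁻¹ (toℕ<n (proj₁ (remQuot {suc N} (suc N) k)))
  y≤N : ∀ k → y k ≤ N
  y≤N k = s≤s⁻¹ (toℕ<n (proj₂ (remQuot {suc N} (suc N) k)))
  residue : Point → Fin e
  residue k = fromℕ< (m%n<n (x k + y k * q) e)
  samePoint : ∀ {k l} → x k ≡ x l → y k ≡ y l → k ≡ l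
  samePoint {k} {l} ≡x ≡y = begin
    k                                               ≡⟨ combine-remQuot {suc N} (suc N) k ⟨
    uncurry combine (remQuot {suc N} (suc N) k)     ≡⟨ cong (uncurry combine) (cong₂ _,_ (toℕ-injective ≡x) (toℕ-injective ≡y)) ⟩
    uncurry combine (remQuot {suc N} (suc N) l)     ≡⟨ combine-remQuot {suc N} (suc N) l ⟩
    l                                               ∎
    where open ≡-Reasoning
  ordered : ∀ {k l} → k ≢ l → y k ≤ y l → (x k + y k * q) % e ≡ (x l + y l * q) % e → SmallRelation e q N
  ordered {k} {l} k≢l yₖ≤yₗ ≡% with v , yₖ+v≡yₗ ← m≤n⇒∃[o]m+o≡n yₖ≤yₗ =
    collision⇒SmallRelation {x₁ = x k} {y₁ = y k} {x₂ = x l} {v = v} N<e (x≤N k) (x≤N l)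
      (subst (_≤ N) (sym yₖ+v≡yₗ) (y≤N l))
      (λ { (≡x , refl) → k≢l (samePoint ≡x (trans (sym (+-identityʳ (y k))) yₖ+v≡yₗ)) })
      (trans ≡% (cong (λ t → (x l + t * q) % e) (sym yₖ+v≡yₗ)))
  fromCollision : (∃₂ λ i j → toℕ i < toℕ j × residue i ≡ residue j) → SmallRelation e q N
  fromCollision (i , j , i<j , residueᵢ≡residueⱼ) with ≤-total (y i) (y j)
  ... | inj₁ yᵢ≤yⱼ = ordered (λ i≡j → <⇒≢ i<j (cong toℕ i≡j)) yᵢ≤yⱼ ≡%
    where
    ≡% = trans (sym (toℕ-fromℕ< _)) (trans (cong toℕ residueᵢ≡residueⱼ) (toℕ-fromℕ< _))
  ... | inj₂ yⱼ≤yᵢ = ordered (λ j≡i → <⇒≢ i<j (cong toℕ (sym j≡i))) yⱼ≤yᵢ ≡%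
    where
    ≡% = trans (sym (toℕ-fromℕ< _)) (trans (cong toℕ (sym residueᵢ≡residueⱼ)) (toℕ-fromℕ< _))

n<m^n : ∀ {m} n → 2 ≤ m → n < m ^ n
n<m^n zero    _   = s≤s z≤n
n<m^n {m} (suc n) 2≤m = begin-strict
  suc n            ≤⟨ n<m^n n 2≤m ⟩
  m ^ n            <⟨ m<m+n (m ^ n) (m^n>0 m {{>-nonZero (<-trans z<s 2≤m)}} n) ⟩
  m ^ n + m ^ n    ≡⟨ cong (m ^ n +_) (+-identityʳ (m ^ n)) ⟨
  2 * m ^ n        ≤⟨ *-monoˡ-≤ (m ^ n) 2≤m ⟩
  m * m ^ n        ∎
  where open ≤-Reasoning

∃-crossing : ∀ (f : ℕ → ℕ) r n → f 0 ≤ r → r < f n → ∃[ k ] f k ≤ r × r < f (suc k)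
∃-crossing f r zero    f0≤r r<f0 = ⊥-elim (<⇒≱ r<f0 f0≤r)
∃-crossing f r (suc n) f0≤r r<fn with r <? f n
... | yes r<fn = ∃-crossing f r n f0≤r r<fn
... | no  r≮fn = n , ≮⇒≥ r≮fn , r<fn

∃-power-between : ∀ M r → 2 ≤ M → 1 ≤ r → ∃[ j ] ∃[ d ] M ^ suc j ≡ suc (r + d) × M ^ suc j ≤ r * M
∃-power-between M r 2≤M 1≤r with j , Mʲ≤r , r<Mʲ⁺¹ ← ∃-crossing (M ^_) r r 1≤r (n<m^n r 2≤M)
                            with d , r+1+d≡Mʲ⁺¹ ← m≤n⇒∃[o]m+o≡n r<Mʲ⁺¹ =
  j , d , sym r+1+d≡Mʲ⁺¹ , subst (M ^ suc j ≤_) (*-comm M r) (*-monoʳ-≤ M Mʲ≤r)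

∃-⌊√⌋ : ∀ e → ∃[ N ] N * N ≤ e × e < suc N * suc N
∃-⌊√⌋ zero = 0 , z≤n , s≤s z≤n
∃-⌊√⌋ (suc e) with N , N²≤e , e<[1+N]² ← ∃-⌊√⌋ e with suc e <? suc N * suc N
... | yes 1+e<[1+N]² = N , m≤n⇒m≤1+n N²≤e , 1+e<[1+N]²
... | no  1+e≮[1+N]² = suc N , ≮⇒≥ 1+e≮[1+N]² ,
  ≤-<-trans e<[1+N]² (*-mono-< (n<1+n (suc N)) (n<1+n (suc N)))

[1+n]*w≤n*n : ∀ {n w} → suc w ≤ n → suc n * w ≤ n * n
[1+n]*w≤n*n {n} {w} 1+w≤n = begin
  w + n * w       ≤⟨ +-monoˡ-≤ (n * w) (≤-trans (n≤1+n w) 1+w≤n) ⟩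
  n + n * w       ≡⟨ *-suc n w ⟨
  n * suc w       ≤⟨ *-monoʳ-≤ n 1+w≤n ⟩
  n * n           ∎
  where open ≤-Reasoning

t≤N+N⇒r*t<e : ∀ {r e N t} → N * N ≤ e → 4 * (r * r) < e → t ≤ N + N → r * t < e
t≤N+N⇒r*t<e {r} {e} {N} {t} N²≤e 4r²<e t≤2N =
  ≤-<-trans (*-monoʳ-≤ r t≤2N) (≰⇒> λ e≤r[2N] → <-irrefl refl (begin-strict
  e * e                           ≤⟨ *-mono-≤ e≤r[2N] e≤r[2N] ⟩
  r * (N + N) * (r * (N + N))     ≡⟨ ring r N ⟩
  4 * (r * r) * (N * N)           ≤⟨ *-monoʳ-≤ (4 * (r * r)) N²≤e ⟩
  4 * (r * r) * e                 <⟨ *-monoˡ-< e {{>-nonZero (≤-<-trans z≤n 4r²<e)}} 4r²<e ⟩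
  e * e                           ∎))
  where
  open ≤-Reasoning
  ring : ∀ r N → r * (N + N) * (r * (N + N)) ≡ 4 * (r * r) * (N * N)
  ring = solve-∀

r[r+d][1+r+d]<e[1+d] : ∀ {s e N} d → let r = 2 + s in
  N * N ≤ e → suc (r + d) ≤ N → r * (2 * s + 2) * (2 * s + 3) < e → r * (r + d) * suc (r + d) < e * suc d
r[r+d][1+r+d]<e[1+d] {s} {e} {N} d N²≤e W≤N cubic with 2 + s ≤? suc d
... | yes r≤1+d = begin-strict
  r * (r + d) * W        <⟨ *-monoˡ-< W r[r+d]<W[1+d] ⟩
  W * suc d * W          ≡⟨ ring W (suc d) ⟩
  W * W * suc d          ≤⟨ *-monoˡ-≤ (suc d) (≤-trans (*-mono-≤ W≤N W≤N) N²≤e) ⟩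
  e * suc d              ∎
  where
  open ≤-Reasoning
  r = 2 + s
  W = suc (r + d)
  r[r+d]<W[1+d] : r * (r + d) < W * suc d
  r[r+d]<W[1+d] = begin-strict
    r * (r + d)          <⟨ m<n+m (r * (r + d)) {r} z<s ⟩
    r + r * (r + d)      ≡⟨ *-suc r (r + d) ⟨
    r * W                ≡⟨ *-comm r W ⟩
    W * r                ≤⟨ *-monoʳ-≤ W r≤1+d ⟩
    W * suc d            ∎
  ring : ∀ W d′ → W * d′ * W ≡ W * W * d′
  ring = solve-∀
... | no r≰1+d = begin-strict
  r * (r + d) * W              ≤⟨ *-mono-≤ (*-monoʳ-≤ r r+d≤) W≤ ⟩
  r * (2 * s + 2) * (2 * s + 3) <⟨ cubic ⟩
  e                             ≤⟨ m≤m*n e (suc d) ⟩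
  e * suc d                     ∎
  where
  open ≤-Reasoning
  r = 2 + s
  W = suc (r + d)
  d≤s : d ≤ s
  d≤s = s≤s⁻¹ (s≤s⁻¹ (≰⇒> r≰1+d))
  ring : ∀ s → 2 + s + s ≡ 2 * s + 2
  ring = solve-∀
  r+d≤ : r + d ≤ 2 * s + 2
  r+d≤ = subst (r + d ≤_) (ring s) (+-monoʳ-≤ r d≤s)
  W≤ : W ≤ 2 * s + 3
  W≤ = subst (W ≤_) (ring′ s) (s≤s (+-monoʳ-≤ r d≤s))
    where
    ring′ : ∀ s → suc (2 + s + s) ≡ 2 * s + 3
    ring′ = solve-∀

r[a+b]<e : ∀ {s e N a b} d → let r = 2 + s ; W = suc (r + d) in
  N * N ≤ e → W ≤ N → r * (2 * s + 2) * (2 * s + 3) < e → a < W → W * b ≤ e → r * (a + b) < e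
r[a+b]<e {s} {e} {N} {a} {b} d N²≤e W≤N cubic a<W Wb≤e = *-cancelʳ-< W (r * (a + b)) e (begin-strict
  r * (a + b) * W                ≡⟨ ring r a b W ⟩
  r * a * W + r * (W * b)        ≤⟨ +-mono-≤ (*-monoˡ-≤ W (*-monoʳ-≤ r (s≤s⁻¹ a<W))) (*-monoʳ-≤ r Wb≤e) ⟩
  r * (r + d) * W + r * e        <⟨ +-monoˡ-< (r * e) (r[r+d][1+r+d]<e[1+d] d N²≤e W≤N cubic) ⟩
  e * suc d + r * e              ≡⟨ ring′ e d r ⟩
  e * W                          ∎)
  where
  open ≤-Reasoning
  r = 2 + s
  W = suc (r + d)
  ring : ∀ r a b W → r * (a + b) * W ≡ r * a * W + r * (W * b)
  ring = solve-∀
  ring′ : ∀ e d r → e * suc d + r * e ≡ e * suc (r + d)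
  ring′ = solve-∀

r²[1+r+d][r+d]<M[e[1+d]] : ∀ {s e M} d → let r = 2 + s ; W = suc (r + d) in
  2 ≤ M → W ≤ r * M → 2 * (r * r * r) ≤ e → r * r * r * suc r < 2 * e → r * r * W * (r + d) < M * (e * suc d)
r²[1+r+d][r+d]<M[e[1+d]] {s} {e} {M} d 2≤M W≤rM 2r³≤e r³[1+r]<2e with 2 + s ≤? suc d
... | yes r≤1+d = *-cancelˡ-< r _ _ (begin-strict
  r * (r * r * W * (r + d))      ≡⟨ ring r W (r + d) ⟩
  W * (r * r * r * (r + d))      ≤⟨ *-monoˡ-≤ (r * r * r * (r + d)) W≤rM ⟩
  r * M * (r * r * r * (r + d))  <⟨ *-monoʳ-< (r * M) {{m*n≢0 r M {{_}} {{>-nonZero (<-trans z<s 2≤M)}}}} r³[r+d]<e[1+d] ⟩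
  r * M * (e * suc d)            ≡⟨ *-assoc r M (e * suc d) ⟩
  r * (M * (e * suc d))          ∎)
  where
  open ≤-Reasoning
  r = 2 + s
  W = suc (r + d)
  ring : ∀ r W t → r * (r * r * W * t) ≡ W * (r * r * r * t)
  ring = solve-∀
  r³[r+d]<e[1+d] : r * r * r * (r + d) < e * suc d
  r³[r+d]<e[1+d] = begin-strict
    r * r * r * (r + d)          <⟨ *-monoʳ-< (r * r * r) (subst (r + d <_) (ring′ d) (s≤s (+-monoˡ-≤ d r≤1+d))) ⟩
    r * r * r * (2 * suc d)      ≡⟨ ring″ (r * r * r) d ⟩
    2 * (r * r * r) * suc d      ≤⟨ *-monoˡ-≤ (suc d) 2r³≤e ⟩
    e * suc d                    ∎
    where
    ring′ : ∀ d → suc (suc d + d) ≡ 2 * suc d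
    ring′ = solve-∀
    ring″ : ∀ R d → R * (2 * suc d) ≡ 2 * R * suc d
    ring″ = solve-∀
... | no r≰1+d with t , refl ← m≤n⇒∃[o]m+o≡n (s≤s⁻¹ (s≤s⁻¹ (≰⇒> r≰1+d))) = begin-strict
  r * r * W * (r + d)            ≡⟨ ring r W (r + d) ⟩
  r * r * (W * (r + d))          ≤⟨ *-monoʳ-≤ (r * r) (subst (W * (r + d) ≤_) (sym (ring′ d t)) (m≤m+n _ _)) ⟩
  r * r * (r * suc r * suc d)    ≡⟨ ring″ r (suc d) ⟩
  r * r * r * suc r * suc d      <⟨ *-monoˡ-< (suc d) r³[1+r]<2e ⟩
  2 * e * suc d                  ≤⟨ *-monoˡ-≤ (suc d) (*-monoˡ-≤ e 2≤M) ⟩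
  M * e * suc d                  ≡⟨ *-assoc M e (suc d) ⟩
  M * (e * suc d)                ∎
  where
  open ≤-Reasoning
  r = 2 + (d + t)
  W = suc (r + d)
  ring : ∀ r W t → r * r * W * t ≡ r * r * (W * t)
  ring = solve-∀
  ring′ : ∀ d t → (2 + (d + t)) * suc (2 + (d + t)) * suc d ≡
          suc (2 + (d + t) + d) * (2 + (d + t) + d) + d * (d * d + t * t + 2 * d * t + 2 * d + 3 * t + 1)
  ring′ = solve-∀
  ring″ : ∀ r y → r * r * (r * suc r * y) ≡ r * r * r * suc r * y
  ring″ = solve-∀

r[g[a+b]]<e : ∀ {s e E g M a b} d → let r = 2 + s ; W = suc (r + d) in
  e ≡ g * E → 2 ≤ M → g * M ≤ r → W ≤ r * M → a < W → W * b ≤ E →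
  2 * (r * r * r) ≤ e → r * r * r * suc r < 2 * e → r * (g * (a + b)) < e
r[g[a+b]]<e {s} {e} {E} {g} {M} {a} {b} d e≡gE 2≤M gM≤r W≤rM a<W Wb≤E 2r³≤e r³[1+r]<2e =
  *-cancelʳ-< W (r * (g * (a + b))) e (begin-strict
    r * (g * (a + b)) * W               ≡⟨ ring r g a b W ⟩
    r * g * a * W + r * (g * (W * b))   ≤⟨ +-mono-≤ (*-monoˡ-≤ W (*-monoʳ-≤ (r * g) (s≤s⁻¹ a<W))) (*-monoʳ-≤ r gWb≤e) ⟩
    r * g * (r + d) * W + r * e         <⟨ +-monoˡ-< (r * e) rg[r+d]W<e[1+d] ⟩
    e * suc d + r * e                   ≡⟨ ring′ e d r ⟩
    e * W                               ∎)
  where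
  open ≤-Reasoning
  r = 2 + s
  W = suc (r + d)
  ring : ∀ r g a b W → r * (g * (a + b)) * W ≡ r * g * a * W + r * (g * (W * b))
  ring = solve-∀
  ring′ : ∀ e d r → e * suc d + r * e ≡ e * suc (r + d)
  ring′ = solve-∀
  gWb≤e : g * (W * b) ≤ e
  gWb≤e = subst (g * (W * b) ≤_) (sym e≡gE) (*-monoʳ-≤ g Wb≤E)
  rg[r+d]W<e[1+d] : r * g * (r + d) * W < e * suc d
  rg[r+d]W<e[1+d] = *-cancelˡ-< M _ _ (begin-strict
    M * (r * g * (r + d) * W)     ≡⟨ ring″ M r g (r + d) W ⟩
    r * (g * M) * W * (r + d)     ≤⟨ *-monoˡ-≤ (r + d) (*-monoˡ-≤ W (*-monoʳ-≤ r gM≤r)) ⟩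
    r * r * W * (r + d)           <⟨ r²[1+r+d][r+d]<M[e[1+d]] d 2≤M W≤rM 2r³≤e r³[1+r]<2e ⟩
    M * (e * suc d)               ∎)
    where
    ring″ : ∀ M r g t W → M * (r * g * t * W) ≡ r * (g * M) * W * t
    ring″ = solve-∀

[r+d]²≤E : ∀ {s e E g M} d → let r = 2 + s ; W = suc (r + d) in
  e ≡ g * E → 0 < g → g * M ≤ r → W ≤ r * M → (s * s + 4 * s + 3) * (s * s + 4 * s + 3) ≤ e → (r + d) * (r + d) ≤ E
[r+d]²≤E {s} {e} {E} {g} {M} d e≡gE 0<g gM≤r W≤rM quartic =
  *-cancelˡ-≤ g {{>-nonZero 0<g}} (*-cancelˡ-≤ g {{>-nonZero 0<g}} (begin
    g * (g * ((r + d) * (r + d)))   ≡⟨ ring g (r + d) ⟩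
    (g * (r + d)) * (g * (r + d))   ≤⟨ *-mono-≤ g[r+d]≤r²-1 g[r+d]≤r²-1 ⟩
    P * P                           ≤⟨ quartic ⟩
    e                               ≡⟨ e≡gE ⟩
    g * E                           ≤⟨ m≤m*n (g * E) g {{>-nonZero 0<g}} ⟩
    g * E * g                       ≡⟨ *-comm (g * E) g ⟩
    g * (g * E)                     ∎))
  where
  open ≤-Reasoning
  r = 2 + s
  P = s * s + 4 * s + 3
  ring : ∀ g t → g * (g * (t * t)) ≡ (g * t) * (g * t)
  ring = solve-∀
  g[r+d]≤r²-1 : g * (r + d) ≤ P
  g[r+d]≤r²-1 = s≤s⁻¹ (begin
    1 + g * (r + d)       ≤⟨ +-monoˡ-≤ (g * (r + d)) 0<g ⟩
    g + g * (r + d)       ≡⟨ *-suc g (r + d) ⟨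
    g * suc (r + d)       ≤⟨ *-monoʳ-≤ g W≤rM ⟩
    g * (r * M)           ≡⟨ ring′ g r M ⟩
    r * (g * M)           ≤⟨ *-monoʳ-≤ r gM≤r ⟩
    r * r                 ≡⟨ ring″ s ⟩
    suc P                 ∎)
    where
    ring′ : ∀ g r M → g * (r * M) ≡ r * (g * M)
    ring′ = solve-∀
    ring″ : ∀ s → (2 + s) * (2 + s) ≡ suc (s * s + 4 * s + 3)
    ring″ = solve-∀

-- Large moduli

ExceptionalPair : ℕ → ℕ → ℕ → Set
ExceptionalPair q e r =
  ∃[ a ] ∃[ b ] (0 < a × 0 < b × gcd a b ≡ 1 × b < a × a ≤ r × a * b ≤ q × b * e ≡ a * (q ∸ 1))

congruence⇒ExceptionalPair : ∀ {q e r v k} → 1 < q → q < e → 0 < v → v ≤ r → v * v ≤ e →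
                             v * q ≡ v + k * e → Coprime v k → ExceptionalPair q e r
congruence⇒ExceptionalPair {q} {e} {r} {v} {k} 1<q q<e 0<v v≤r v²≤e vq≡ coprime =
  v , k , 0<v , 0<k , coprime⇒gcd≡1 coprime , k<v , v≤r , vk≤q , ke≡
  where
  open ≤-Reasoning
  instance
    v≢0 : NonZero v
    v≢0 = >-nonZero 0<v
  ke≡ : k * e ≡ v * (q ∸ 1)
  ke≡ = sym (begin-equality
    v * (q ∸ 1)       ≡⟨ *-distribˡ-∸ v q 1 ⟩
    v * q ∸ v * 1     ≡⟨ cong₂ _∸_ vq≡ (*-identityʳ v) ⟩
    v + k * e ∸ v     ≡⟨ m+n∸m≡n v (k * e) ⟩
    k * e             ∎)
  0<k : 0 < k
  0<k = n≢0⇒n>0 λ { refl → <-irrefl (sym (*-cancelˡ-≡ q 1 v (trans vq≡ (trans (+-identityʳ v) (sym (*-identityʳ v)))))) 1<q }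
  k<v : k < v
  k<v = *-cancelʳ-< e k v (begin-strict
    k * e             ≡⟨ ke≡ ⟩
    v * (q ∸ 1)       <⟨ *-monoʳ-< v (≤-<-trans (m∸n≤m q 1) q<e) ⟩
    v * e             ∎)
  vk≤q : v * k ≤ q
  vk≤q = *-cancelʳ-≤ (v * k) q e {{>-nonZero (<-trans (<-trans z<s 1<q) q<e)}} (begin
    v * k * e         ≡⟨ *-assoc v k e ⟩
    v * (k * e)       ≡⟨ cong (v *_) ke≡ ⟩
    v * (v * (q ∸ 1)) ≡⟨ *-assoc v v (q ∸ 1) ⟨
    v * v * (q ∸ 1)   ≤⟨ *-mono-≤ v²≤e (m∸n≤m q 1) ⟩
    e * q             ≡⟨ *-comm e q ⟩
    q * e             ∎)

-- With r = 2 + s: (r² − 1)² ≤ e, 2 r³ ≤ e, r (2r − 2) (2r − 1) < e, r³ (r + 1) < 2 e and 4 r² < e.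
record LargeModulus (s e : ℕ) : Set where
  field
    quartic  : (s * s + 4 * s + 3) * (s * s + 4 * s + 3) ≤ e
    cubic    : 2 * ((2 + s) * (2 + s) * (2 + s)) ≤ e
    cubic′   : (2 + s) * (2 * s + 2) * (2 * s + 3) < e
    quartic′ : (2 + s) * (2 + s) * (2 + s) * suc (2 + s) < 2 * e
    square   : 4 * ((2 + s) * (2 + s)) < e

module _ {q e m s : ℕ} (1<q : 1 < q) (q<e : q < e) (isM : IsM q e m) (e≤m[2+s] : e ≤ m * (2 + s))
         (large : LargeModulus s e) where

  open LargeModulus large
  private
    r = 2 + s
    0<e : 0 < e
    0<e = <-trans (<-trans z<s 1<q) q<e
    ¬short : ¬ ShortRepresentation q e r
    ¬short = IsM⇒¬ShortRepresentation isM e≤m[2+s]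

  ¬zero-sum : ∀ {N x y} → N * N ≤ e → x ≤ N → y ≤ N → 0 < y → e ∣ x + y * q → ⊥
  ¬zero-sum {N} {x} {y} N²≤e x≤N y≤N 0<y e∣ =
    ¬short (ShortRepresentation[q¹] {q} {e} {r} x y (≤-trans 0<y (m≤n+m y x))
      (t≤N+N⇒r*t<e {r} {e} {N} {x + y} N²≤e square (+-mono-≤ x≤N y≤N)) e∣)

  ¬congruence[r<u] : ∀ {N u v k} → N * N ≤ e → r < u → u ≤ N → 0 < v → v ≤ N →
                     v * q ≡ u + k * e → Coprime v k → ⊥
  ¬congruence[r<u] {N} {u} {suc w} {k} N²≤e r<u u≤N _ v≤N vq≡ coprime
    with d , refl ← m≤n⇒∃[o]m+o≡n r<u
    = absurd (∃shortSolution[x<U] {e} {q} {suc r + d} {suc w} {k} vq≡ coprime 0<e refl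
               (≤-trans (*-mono-≤ u≤N (≤-trans (n≤1+n w) v≤N)) N²≤e) refl)
    where
    absurd : ∃[ x ] ∃[ y ] 0 < x + y × x < suc r + d × (suc r + d) * y ≤ e × e ∣ x + y * q → ⊥
    absurd (x , y , 0<x+y , x<u , uy≤e , e∣) =
      ¬short (ShortRepresentation[q¹] {q} {e} {r} x y 0<x+y (r[a+b]<e {s} {e} {N} {x} {y} d N²≤e u≤N cubic′ x<u uy≤e) e∣)

  ¬congruence[r<v] : ∀ {N u v k} → N * N ≤ e → r < v → v ≤ N → u ≤ N → v * q ≡ u + k * e → Coprime v k → ⊥
  ¬congruence[r<v] {N} {u} {v} {k} N²≤e r<v v≤N u≤N vq≡ coprime with d , refl ← m≤n⇒∃[o]m+o≡n r<v =
    absurd (∃shortSolution[y<V] {e} {q} {u} {suc r + d} {k} vq≡ coprime 0<e refl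
              (≤-trans (*-mono-≤ u≤N (≤-trans (n≤1+n (r + d)) v≤N)) N²≤e))
    where
    absurd : ∃[ x ] ∃[ y ] 0 < x + y × y < suc r + d × (suc r + d) * x ≤ e × e ∣ x + y * q → ⊥
    absurd (x , y , 0<x+y , y<v , vx≤e , e∣) = ¬short (ShortRepresentation[q¹] {q} {e} {r} x y 0<x+y
      (subst (λ t → r * t < e) (+-comm y x) (r[a+b]<e {s} {e} {N} {y} {x} d N²≤e v≤N cubic′ y<v vx≤e)) e∣)

  private
    0<E : ∀ {g E} → e ≡ g * E → 0 < E
    0<E {g} {zero}  e≡gE = ⊥-elim (<-irrefl (sym (trans e≡gE (*-zeroʳ g))) 0<e)
    0<E {g} {suc E} _    = z<s

  ¬scaled-relation[U<W] : ∀ {E g M d J U K} → let W = suc (r + d) in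
    e ≡ g * E → 0 < g → 2 ≤ M → g * M ≤ r → W ≤ r * M → U ≤ r + d → W * q ^ J ≡ U + K * E → Coprime W K → ⊥
  ¬scaled-relation[U<W] {E} {g} {M} {d} {J} {U} {K} e≡gE 0<g 2≤M gM≤r W≤rM U≤r+d rel coprime =
    absurd (∃shortSolution[y<V] {E} {q ^ J} {U} {suc (r + d)} {K} rel coprime (0<E {g} {E} e≡gE) refl
              (≤-trans (*-monoˡ-≤ (r + d) U≤r+d) ([r+d]²≤E {s} {e} {E} {g} {M} d e≡gE 0<g gM≤r W≤rM quartic)))
    where
    absurd : ∃[ x ] ∃[ y ] 0 < x + y × y < suc (r + d) × suc (r + d) * x ≤ E × E ∣ x + y * q ^ J → ⊥
    absurd (x , y , 0<x+y , y<W , Wx≤E , E∣) = ¬short (ShortRepresentation-scale {r = r} x y J e≡gE 0<g 0<x+y E∣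
      (subst (λ t → r * (g * t) < e) (+-comm y x)
        (r[g[a+b]]<e {s} {e} {E} {g} {M} {y} {x} d e≡gE 2≤M gM≤r W≤rM y<W Wx≤E cubic quartic′)))

  ¬scaled-relation[V<W] : ∀ {E g M d J V K} → let W = suc (r + d) in
    e ≡ g * E → 0 < g → 2 ≤ M → g * M ≤ r → W ≤ r * M → 0 < V → V ≤ r + d →
    V * q ^ J ≡ W + K * E → Coprime V K → ⊥
  ¬scaled-relation[V<W] {E} {g} {M} {d} {J} {suc w} {K} e≡gE 0<g 2≤M gM≤r W≤rM _ V≤r+d rel coprime =
    absurd (∃shortSolution[x<U] {E} {q ^ J} {suc (r + d)} {suc w} {K} rel coprime (0<E {g} {E} e≡gE) refl
              (≤-trans ([1+n]*w≤n*n V≤r+d) ([r+d]²≤E {s} {e} {E} {g} {M} d e≡gE 0<g gM≤r W≤rM quartic)) refl)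
    where
    absurd : ∃[ x ] ∃[ y ] 0 < x + y × x < suc (r + d) × suc (r + d) * y ≤ E × E ∣ x + y * q ^ J → ⊥
    absurd (x , y , 0<x+y , x<W , Wy≤E , E∣) = ¬short (ShortRepresentation-scale {r = r} x y J e≡gE 0<g 0<x+y E∣
      (r[g[a+b]]<e {s} {e} {E} {g} {M} {x} {y} d e≡gE 2≤M gM≤r W≤rM x<W Wy≤E cubic quartic′))

  ¬scaled-congruence : ∀ {E g u v k} → e ≡ g * E → 0 < g → g * u ≤ r → g * v ≤ r → 0 < u → 0 < v → u ≢ v →
                       v * q ≡ u + k * E → Coprime v u → ⊥
  ¬scaled-congruence {E} {g} {u} {v} {k} e≡gE 0<g gu≤r gv≤r 0<u 0<v u≢v vq≡ coprime with <-cmp u v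
  ... | tri≈ _ u≡v _ = u≢v u≡v
  ... | tri< u<v _ _ = absurd (∃-power-between v r 2≤v (s≤s z≤n))
    where
    2≤v = ≤-trans (s≤s 0<u) u<v
    absurd : ∃[ j ] ∃[ d ] v ^ suc j ≡ suc (r + d) × v ^ suc j ≤ r * v → ⊥
    absurd (j , d , W≡ , W≤rv) =
      ¬scaled-relation[U<W] {E} {g} {v} {d} {suc j} {u ^ suc j} {K} e≡gE 0<g 2≤v gv≤r (subst (_≤ r * v) W≡ W≤rv)
        (s≤s⁻¹ (subst (u ^ suc j <_) W≡ (^-monoˡ-< (suc j) u<v)))
        (subst (λ t → t * q ^ suc j ≡ u ^ suc j + K * E) W≡ rel)
        (subst (λ t → Coprime t K) W≡
          (relation⇒coprime {E} {q ^ suc j} {u ^ suc j} {v ^ suc j} {K} rel (coprime-^ (suc j) coprime)))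
      where
      powered = relation-^ {E} {q} {u} {v} {k} vq≡ (suc j)
      K = proj₁ powered
      rel = proj₂ powered
  ... | tri> _ _ v<u = absurd (∃-power-between u r 2≤u (s≤s z≤n))
    where
    2≤u = ≤-trans (s≤s 0<v) v<u
    absurd : ∃[ j ] ∃[ d ] u ^ suc j ≡ suc (r + d) × u ^ suc j ≤ r * u → ⊥
    absurd (j , d , W≡ , W≤ru) =
      ¬scaled-relation[V<W] {E} {g} {u} {d} {suc j} {v ^ suc j} {K} e≡gE 0<g 2≤u gu≤r (subst (_≤ r * u) W≡ W≤ru)
        (m^n>0 v {{>-nonZero 0<v}} (suc j))
        (s≤s⁻¹ (subst (v ^ suc j <_) W≡ (^-monoˡ-< (suc j) v<u)))
        (subst (λ t → v ^ suc j * q ^ suc j ≡ t + K * E) W≡ rel)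
        (relation⇒coprime {E} {q ^ suc j} {u ^ suc j} {v ^ suc j} {K} rel (coprime-^ (suc j) coprime))
      where
      powered = relation-^ {E} {q} {u} {v} {k} vq≡ (suc j)
      K = proj₁ powered
      rel = proj₂ powered

  ¬congruence[u≢v≤r] : ∀ {u v k} → 0 < u → 0 < v → u ≤ r → v ≤ r → u ≢ v →
                       v * q ≡ u + k * e → Coprime v k → ⊥
  ¬congruence[u≢v≤r] {u} {v} {k} 0<u 0<v u≤r v≤r u≢v vq≡ coprime =
    ¬scaled-congruence {E} {g} {quotient g∣u} {quotient g∣v} {k} e≡gE (>-nonZero⁻¹ g)
      (subst (_≤ r) (m∣n⇒n≡m*quotient g∣u) u≤r) (subst (_≤ r) (m∣n⇒n≡m*quotient g∣v) v≤r)
      (quotient-pos 0<u g∣u) (quotient-pos 0<v g∣v)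
      (λ u′≡v′ → u≢v (trans (_∣_.equality g∣u) (trans (cong (_* g) u′≡v′) (sym (_∣_.equality g∣v)))))
      (relation-/-common-factor {q} {e} {u} {v} {k} g (quotient g∣u) (quotient g∣v) k E
        (_∣_.equality g∣u) (_∣_.equality g∣v) ke≡kEg vq≡)
      (Coprime-sym (coprime-quotients-gcd u v))
    where
    g = gcd u v
    instance
      g≢0 : NonZero g
      g≢0 = ≢-nonZero (gcd[m,n]≢0 u v (inj₁ (≢-nonZero⁻¹ u {{>-nonZero 0<u}})))
    g∣u = gcd[m,n]∣m u v
    g∣v = gcd[m,n]∣n u v
    g∣e : g ∣ e
    g∣e = coprime-divisor (λ (d∣g , d∣k) → coprime (∣-trans d∣g g∣v , d∣k))
            (∣m+n∣m⇒∣n (subst (g ∣_) vq≡ (∣m⇒∣m*n q g∣v)) g∣u)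
    E = quotient g∣e
    e≡gE : e ≡ g * E
    e≡gE = m∣n⇒n≡m*quotient g∣e
    ke≡kEg : k * e ≡ k * E * g
    ke≡kEg = trans (cong (k *_) (_∣_.equality g∣e)) (sym (*-assoc k E g))

  largeModulus⇒ExceptionalPair : ExceptionalPair q e r
  largeModulus⇒ExceptionalPair = fromSquareRoot (∃-⌊√⌋ e)
    where
    fromSquareRoot : ∃[ N ] N * N ≤ e × e < suc N * suc N → ExceptionalPair q e r
    fromSquareRoot (N , N²≤e , e<[1+N]²) = fromRelation (pigeonhole⇒SmallRelation e q N {{>-nonZero 0<e}} N<e e<[1+N]²)
      where
      N<e : N < e
      N<e = ≰⇒> λ e≤N → <⇒≱ (m<m*n e e {{>-nonZero 0<e}} (<-trans 1<q q<e)) (≤-trans (*-mono-≤ e≤N e≤N) N²≤e)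
      fromRelation : SmallRelation e q N → ExceptionalPair q e r
      fromRelation (zero-sum {x} {y} x≤N y≤N 0<y e∣) = ⊥-elim (¬zero-sum {N} {x} {y} N²≤e x≤N y≤N 0<y e∣)
      fromRelation (congruence {u} {v} {k} 0<u u≤N 0<v v≤N vq≡ coprime) with r <? u | r <? v | u ≟ v
      ... | yes r<u | _       | _      = ⊥-elim (¬congruence[r<u] {N} {u} {v} {k} N²≤e r<u u≤N 0<v v≤N vq≡ coprime)
      ... | no _    | yes r<v | _      = ⊥-elim (¬congruence[r<v] {N} {u} {v} {k} N²≤e r<v v≤N u≤N vq≡ coprime)
      ... | no r≮u  | no r≮v  | no u≢v =
        ⊥-elim (¬congruence[u≢v≤r] {u} {v} {k} 0<u 0<v (≮⇒≥ r≮u) (≮⇒≥ r≮v) u≢v vq≡ coprime)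
      ... | no _    | no r≮v  | yes refl =
        congruence⇒ExceptionalPair {q} {e} {r} {v} {k} 1<q q<e 0<v (≮⇒≥ r≮v)
          (≤-trans (*-mono-≤ v≤N v≤N) N²≤e) vq≡ coprime

largeModulus[r≡2] : ∀ {e} → 17 ≤ e → LargeModulus 0 e
largeModulus[r≡2] 17≤e = record
  { quartic  = ≤-trans (≤ᵇ⇒≤ 9 17 _) 17≤e
  ; cubic    = ≤-trans (≤ᵇ⇒≤ 16 17 _) 17≤e
  ; cubic′   = <-≤-trans (<ᵇ⇒< 12 17 _) 17≤e
  ; quartic′ = <-≤-trans (<ᵇ⇒< 24 34 _) (*-monoʳ-≤ 2 17≤e)
  ; square   = <-≤-trans (<ᵇ⇒< 16 17 _) 17≤e
  }

largeModulus[r≥3] : ∀ t {e} → (3 + t) ^ 4 < e + 2 * (3 + t) ^ 2 → LargeModulus (1 + t) e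
largeModulus[r≥3] t {e} r⁴<e+2r² = record
  { quartic  = P²≤e
  ; cubic    = ≤-trans 2r³≤P² P²≤e
  ; cubic′   = <-≤-trans r[2r-2][2r-1]<P² P²≤e
  ; quartic′ = <-≤-trans r³[r+1]<2P² (*-monoʳ-≤ 2 P²≤e)
  ; square   = <-≤-trans 4r²<P² P²≤e
  }
  where
  r = 3 + t
  P = (1 + t) * (1 + t) + 4 * (1 + t) + 3
  P²≤e : P * P ≤ e
  P²≤e = +-cancelʳ-≤ (2 * (r * (r * 1))) (P * P) e (subst (_≤ e + 2 * (r * (r * 1))) (sym (ring t)) r⁴<e+2r²)
    where
    ring : ∀ t → let r = 3 + t ; P = (1 + t) * (1 + t) + 4 * (1 + t) + 3 in
           P * P + 2 * (r * (r * 1)) ≡ suc (r * (r * (r * (r * 1))))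
    ring = solve-∀
  2r³≤P² : 2 * (r * r * r) ≤ P * P
  2r³≤P² = subst (2 * (r * r * r) ≤_) (sym (ring t))
    (m≤m+n (2 * (r * r * r)) (10 + 42 * t + 34 * t * t + 10 * t * t * t + t * t * t * t))
    where
    ring : ∀ t → let r = 3 + t ; P = (1 + t) * (1 + t) + 4 * (1 + t) + 3 in
           P * P ≡ 2 * (r * r * r) + (10 + 42 * t + 34 * t * t + 10 * t * t * t + t * t * t * t)
    ring = solve-∀
  r[2r-2][2r-1]<P² : r * (2 * (1 + t) + 2) * (2 * (1 + t) + 3) < P * P
  r[2r-2][2r-1]<P² = subst (r * (2 * (1 + t) + 2) * (2 * (1 + t) + 3) <_) (sym (ring t))
    (s≤s (m≤m+n (r * (2 * (1 + t) + 2) * (2 * (1 + t) + 3)) (3 + 22 * t + 22 * t * t + 8 * t * t * t + t * t * t * t)))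
    where
    ring : ∀ t → let r = 3 + t ; P = (1 + t) * (1 + t) + 4 * (1 + t) + 3 in
           P * P ≡ suc (r * (2 * (1 + t) + 2) * (2 * (1 + t) + 3) + (3 + 22 * t + 22 * t * t + 8 * t * t * t + t * t * t * t))
    ring = solve-∀
  r³[r+1]<2P² : r * r * r * suc r < 2 * (P * P)
  r³[r+1]<2P² = subst (r * r * r * suc r <_) (sym (ring t))
    (s≤s (m≤m+n (r * r * r * suc r) (19 + 57 * t + 41 * t * t + 11 * t * t * t + t * t * t * t)))
    where
    ring : ∀ t → let r = 3 + t ; P = (1 + t) * (1 + t) + 4 * (1 + t) + 3 in
           2 * (P * P) ≡ suc (r * r * r * suc r + (19 + 57 * t + 41 * t * t + 11 * t * t * t + t * t * t * t))
    ring = solve-∀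
  4r²<P² : 4 * (r * r) < P * P
  4r²<P² = subst (4 * (r * r) <_) (sym (ring t))
    (s≤s (m≤m+n (4 * (r * r)) (27 + 72 * t + 48 * t * t + 12 * t * t * t + t * t * t * t)))
    where
    ring : ∀ t → let r = 3 + t ; P = (1 + t) * (1 + t) + 4 * (1 + t) + 3 in
           P * P ≡ suc (4 * (r * r) + (27 + 72 * t + 48 * t * t + 12 * t * t * t + t * t * t * t))
    ring = solve-∀

-- Small moduli

SmallShortRepresentation : ℕ → ℕ → Set
SmallShortRepresentation q e =
  ∃[ x ] ∃[ y ] ∃[ j ] 0 < toℕ {6} x + toℕ {6} y × 2 * (toℕ x + toℕ y) < e × e ∣ toℕ x + toℕ y * q ^ toℕ {7} j

smallShortRepresentation? : ∀ q e → Dec (SmallShortRepresentation q e)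
smallShortRepresentation? q e = any? λ x → any? λ y → any? λ j →
  (0 <? toℕ x + toℕ y) ×-dec (2 * (toℕ x + toℕ y) <? e) ×-dec (e ∣? toℕ x + toℕ y * q ^ toℕ j)

smallModuli : ∀ (i : Fin 8) (k : Fin 15) → let e = 9 + toℕ i ; q = 2 + toℕ k in
              q < e → e ≡ 2 * (q ∸ 1) ⊎ SmallShortRepresentation q e
smallModuli = toWitness {a? = all? λ i → all? λ k → let e = 9 + toℕ i ; q = 2 + toℕ k in
  (q <? e) →-dec ((e ≟ 2 * (q ∸ 1)) ⊎-dec smallShortRepresentation? q e)} _

∃[i]m+i≡n : ∀ {m n} k → m ≤ n → n < m + k → ∃[ i ] m + toℕ {k} i ≡ n
∃[i]m+i≡n {m} {n} k m≤n n<m+k = fromℕ< (+-cancelˡ-< m (n ∸ m) k (subst (_< m + k) (sym (m+[n∸m]≡n m≤n)) n<m+k)) ,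
  trans (cong (m +_) (toℕ-fromℕ< _)) (m+[n∸m]≡n m≤n)

smallModulus : ∀ {q e} → 2 ≤ q → q < e → 9 ≤ e → e ≤ 16 → e ≡ 2 * (q ∸ 1) ⊎ ShortRepresentation q e 2
smallModulus {q} {e} 2≤q q<e 9≤e e≤16
  with i , refl ← ∃[i]m+i≡n 8 9≤e (s≤s e≤16)
  with k , refl ← ∃[i]m+i≡n 15 2≤q (<-≤-trans q<e (m≤n⇒m≤1+n e≤16)) = fromTable (smallModuli i k q<e)
  where
  fromTable : e ≡ 2 * (q ∸ 1) ⊎ SmallShortRepresentation q e → e ≡ 2 * (q ∸ 1) ⊎ ShortRepresentation q e 2
  fromTable (inj₁ e≡2[q-1]) = inj₁ e≡2[q-1]
  fromTable (inj₂ (x , y , j , 0<x+y , 2[x+y]<e , e∣)) = inj₂ (toℕ x , toℕ y , toℕ j , 0<x+y , 2[x+y]<e , e∣)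

IsM⇒ExceptionalPair : ∀ {q e m r} → 0 < r → 1 < q → q < e → IsM q e m → e ≤ m * r → r ^ 4 < e + 2 * r ^ 2 →
                      ExceptionalPair q e r
IsM⇒ExceptionalPair {q} {e} {m} {1} _ 1<q q<e isM e≤m _ = ⊥-elim (IsM⇒¬ShortRepresentation isM e≤m short)
  where
  e∸q+q≡e : e ∸ q + 1 * q ≡ e
  e∸q+q≡e = trans (cong (e ∸ q +_) (*-identityˡ q)) (m∸n+n≡m (<⇒≤ q<e))
  short : ShortRepresentation q e 1
  short = ShortRepresentation[q¹] {q} {e} {1} (e ∸ q) 1 (m≤n+m 1 (e ∸ q)) bound (subst (e ∣_) (sym e∸q+q≡e) ∣-refl)
    where
    open ≤-Reasoning
    bound : 1 * (e ∸ q + 1) < e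
    bound = begin-strict
      1 * (e ∸ q + 1)   ≡⟨ *-identityˡ _ ⟩
      e ∸ q + 1         <⟨ +-monoʳ-< (e ∸ q) 1<q ⟩
      e ∸ q + q         ≡⟨ m∸n+n≡m (<⇒≤ q<e) ⟩
      e                 ∎
-- For r = 2 the hypothesis only gives e ≥ 9, whereas LargeModulus 0 e needs e ≥ 17.
IsM⇒ExceptionalPair {q} {e} {m} {2} _ 1<q q<e isM e≤2m r⁴<e+2r² with e ≤? 16
... | yes e≤16 = fromSmall (smallModulus 1<q q<e (+-cancelʳ-≤ 8 9 e r⁴<e+2r²) e≤16)
  where
  fromSmall : e ≡ 2 * (q ∸ 1) ⊎ ShortRepresentation q e 2 → ExceptionalPair q e 2
  fromSmall (inj₁ e≡2[q-1]) = 2 , 1 , z<s , z<s , refl , ≤-refl , ≤-refl , subst (_≤ q) (sym (*-identityʳ 2)) 1<q ,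
                              trans (*-identityˡ e) e≡2[q-1]
  fromSmall (inj₂ short)    = ⊥-elim (IsM⇒¬ShortRepresentation isM e≤2m short)
... | no e≰16 = largeModulus⇒ExceptionalPair {q} {e} {m} {0} 1<q q<e isM e≤2m (largeModulus[r≡2] (≰⇒> e≰16))
IsM⇒ExceptionalPair {q} {e} {m} {suc (suc (suc t))} _ 1<q q<e isM e≤rm r⁴<e+2r² =
  largeModulus⇒ExceptionalPair {q} {e} {m} {1 + t} 1<q q<e isM e≤rm (largeModulus[r≥3] t r⁴<e+2r²)

proposition2 : ∀ (q e r : ℕ) → 0 < q → 0 < e → 0 < r → gcd q e ≡ 1 → 1 < q → q < e →
    ((a b : ℕ) → 0 < a → 0 < b → gcd a b ≡ 1 → b < a → a ≤ r → a * b ≤ q → b * e ≡ a * (q ∸ 1) →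
      IsM q e (gcd e (q ∸ 1)) × (gcd e (q ∸ 1) * a ≡ e) × (e ≤ gcd e (q ∸ 1) * r))
    × ((m : ℕ) → IsM q e m → e ≤ m * r → r ^ 4 < e + 2 * r ^ 2 →
      ∃[ a ] ∃[ b ] (0 < a × 0 < b × gcd a b ≡ 1 × b < a × a ≤ r × a * b ≤ q × b * e ≡ a * (q ∸ 1)))
-- 0 < q and 0 < e follow from 1 < q < e, and gcd q e ≡ 1 only ensures that m exists, which IsM presupposes.
proposition2 q e r _ _ 0<r _ 1<q q<e =
  (λ a b 0<a _ gcd[a,b]≡1 _ a≤r ab≤q be≡ → exceptionalPair⇒IsM {q} {e} {r} {a} {b} 1<q 0<a gcd[a,b]≡1 a≤r ab≤q be≡) ,
  (λ m isM e≤mr r⁴<e+2r² → IsM⇒ExceptionalPair 0<r 1<q q<e isM e≤mr r⁴<e+2r²)
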